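{- Let $p$ be an odd prime, $\Gamma=C_p\rtimes C_r=\langle \sigma, \tau : \sigma^p = 1 = \tau^r,\ \tau\sigma\tau^{ -1} = \sigma^s\rangle$ with the class of $s$ in $(\mathbb{Z}/p\mathbb{Z})^\times$ of exact order $r$, and $G=\Gamma\times\{1,j\}$ with $j$ of order 2. Let $I\subset D\subset G$ be subgroups with $I$ normal in $D$ and $D/I$ cyclic, and suppose $p\mid\#I$ and $j\notin D$. Then either (I) $D=\langle\sigma,\tau^{r/e}\rangle$ and $I=\langle\sigma,\tau^{r/d}\rangle$ for some positive divisors $d\mid e\mid r$, or (II) $D=\langle\sigma,\tau^{r/e}j\rangle$ and $I=\langle\sigma,(\tau^{r/e}j)^{e/d}\rangle$ for some positive divisors $d\mid e\mid r$ with $e$ even. -}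

module Defs where

open import Data.Nat using (ℕ; zero; suc; _+_; _*_; _∸_; _^_; NonZero)
open import Data.Nat.DivMod using (_mod_)
open import Data.Fin using (Fin; toℕ)
open import Data.Bool using (Bool; true; false; if_then_else_)
open import Data.List using (List; []; _∷_; map; concatMap; allFin)
open import Data.Nat.ListAction using (sum)
open import Data.List.Membership.Propositional using (_∈_)
open import Data.Product using (_×_)
open import Relation.Binary.PropositionalEquality using (_≡_)

-- An element σ^a τ^b j^c of G = (C_p ⋊ C_r) × {1, j}, with a mod p, b mod r, c mod 2.
record Elem (p r : ℕ) : Set where
  constructor ⟨_,_,_⟩
  field
    a : Fin p
    b : Fin r
    c : Fin 2

module G (p r s : ℕ) {{_ : NonZero p}} {{_ : NonZero r}} where

  El : Set
  El = Elem p r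

  _·_ : El → El → El
  ⟨ a , b , c ⟩ · ⟨ a' , b' , c' ⟩ =
    ⟨ (toℕ a + s ^ toℕ b * toℕ a') mod p , (toℕ b + toℕ b') mod r , (toℕ c + toℕ c') mod 2 ⟩

  ε : El
  ε = ⟨ 0 mod p , 0 mod r , 0 mod 2 ⟩

  -- inverse (valid when s^r ≡ 1 mod p): σ^(-a s^(r-b)) τ^(-b) j^c
  inv : El → El
  inv ⟨ a , b , c ⟩ = ⟨ ((p ∸ toℕ a) * s ^ (r ∸ toℕ b)) mod p , (r ∸ toℕ b) mod r , c ⟩

  σ τ j : El
  σ = ⟨ 1 mod p , 0 mod r , 0 mod 2 ⟩
  τ = ⟨ 0 mod p , 1 mod r , 0 mod 2 ⟩
  j = ⟨ 0 mod p , 0 mod r , 1 mod 2 ⟩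

  pow : El → ℕ → El
  pow g zero = ε
  pow g (suc k) = g · pow g k

  allElems : List El
  allElems = concatMap (λ a → concatMap (λ b → map (λ c → ⟨ a , b , c ⟩) (allFin 2)) (allFin r)) (allFin p)

  record Subgroup : Set where
    field
      mem   : El → Bool
      ε∈    : mem ε ≡ true
      ·∈    : ∀ x y → mem x ≡ true → mem y ≡ true → mem (x · y) ≡ true
      inv∈  : ∀ x → mem x ≡ true → mem (inv x) ≡ true
  open Subgroup public

  _∈S_ : El → Subgroup → Set
  x ∈S H = mem H x ≡ true

  _⊆S_ : Subgroup → Subgroup → Set
  H ⊆S K = ∀ x → x ∈S H → x ∈S K

  card : Subgroup → ℕ
  card H = sum (map (λ x → if mem H x then 1 else 0) allElems)

  NormalIn : Subgroup → Subgroup → Set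
  NormalIn I D = ∀ d i → d ∈S D → i ∈S I → ((d · i) · inv d) ∈S I

  CyclicQuotient : Subgroup → Subgroup → Set
  CyclicQuotient D I = Data.Product.Σ El λ g → g ∈S D ×
    (∀ x → x ∈S D → Data.Product.Σ ℕ λ k → (inv (pow g k) · x) ∈S I)

  data ⟨_⟩∋_ (gens : List El) : El → Set where
    gen : ∀ {x} → x ∈ gens → ⟨ gens ⟩∋ x
    one : ⟨ gens ⟩∋ ε
    mul : ∀ {x y} → ⟨ gens ⟩∋ x → ⟨ gens ⟩∋ y → ⟨ gens ⟩∋ (x · y)
    neg : ∀ {x} → ⟨ gens ⟩∋ x → ⟨ gens ⟩∋ (inv x)

  IsGeneratedBy : Subgroup → List El → Set
  IsGeneratedBy H gens = ∀ x → (x ∈S H → ⟨ gens ⟩∋ x) × (⟨ gens ⟩∋ x → x ∈S H)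

-- Since the order r of s modulo p is less than p, a subgroup H of G with
-- p ∣ #H contains σ: otherwise H meets ⟨σ⟩ trivially, so each coset of ⟨σ⟩
-- meets H at most once, all nonempty "rows" {σ^a τ^b j^c ∈ H} (b fixed) have
-- the same size K ≤ 2 as the row of ε, and #H = t·K with 0 < t ≤ r < p.
-- If σ ∈ H and j ∉ H, the τ-exponents of H are the multiples of some m ∣ r,
-- and the j-exponent of an element of H is determined by its τ-exponent,
-- so H = ⟨σ, τ^m j^c⟩.  For I ⊆ D the generator of I is then a power
-- (τ^m j^c)^k of that of D; c = 0 is case (I) and c = 1 is case (II), where
-- (τ^m j)^(r/m) = j^(r/m) ∈ D forces r/m to be even.

module Submission where

open import Defs
open import Data.Bool using (Bool; true; false; if_then_else_)
import Data.Bool.Properties as Bool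
open import Data.Empty using (⊥-elim)
open import Data.Fin as Fin using (Fin; toℕ; zero; suc)
open import Data.Fin.Properties using (toℕ-injective; toℕ-fromℕ<; toℕ<n; any?; pigeonhole)
import Data.Fin.Properties as Finₚ
open import Data.List using (List; []; _∷_; _++_; map; concatMap; tabulate; allFin)
open import Data.List.Properties using (map-++; map-tabulate)
open import Data.List.Relation.Unary.Any using (here; there)
open import Data.List.Membership.Propositional using (_∈_)
open import Data.Nat as ℕ using (ℕ; zero; suc; _+_; _*_; _∸_; _^_; _%_; _<_; _≤_; z≤n; s≤s; z<s; NonZero; >-nonZero; >-nonZero⁻¹; s<s⁻¹; nonTrivial⇒n>1)
open import Data.Nat.DivMod
open import Data.Nat.Divisibility using (_∣_; divides; ∣-refl; ∣-trans; m∣m*n; m%n≡0⇒n∣m; n∣m⇒m%n≡0; >⇒∤)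
open import Data.Nat.ListAction using (sum)
open import Data.Nat.ListAction.Properties using (sum-++)
open import Data.Nat.Primality using (Prime; euclidsLemma; prime⇒irreducible; prime⇒nonTrivial)
open import Data.Nat.Properties
open import Algebra.Properties.CommutativeMonoid.Sum +-0-commutativeMonoid
  using (sum-syntax; ∑-comm; sum-cong-≗)
open import Data.Nat.Tactic.RingSolver using (solve-∀)
open import Data.Product using (Σ; ∃; _×_; _,_; proj₂)
open import Data.Sum using (_⊎_; inj₁; inj₂)
open import Relation.Binary.PropositionalEquality
open import Relation.Nullary using (¬_; Dec; yes; no; contradiction)
open import Relation.Unary using (Pred; Decidable)
open import Level using (0ℓ)
open import Function using (_∘_; id)

toℕ-mod : ∀ m n .{{_ : NonZero n}} → toℕ (m mod n) ≡ m % n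
toℕ-mod m n = toℕ-fromℕ< (m%n<n m n)

toℕ-mod-% : ∀ m n .{{_ : NonZero n}} → toℕ (m mod n) % n ≡ m % n
toℕ-mod-% m n = trans (cong (_% n) (toℕ-mod m n)) (m%n%n≡m%n m n)

mod-cong : ∀ {m m'} n .{{_ : NonZero n}} → m % n ≡ m' % n → m mod n ≡ m' mod n
mod-cong {m} {m'} n eq = toℕ-injective (trans (toℕ-mod m n) (trans eq (sym (toℕ-mod m' n))))

0%n≡0 : ∀ n .{{_ : NonZero n}} → 0 % n ≡ 0
0%n≡0 n = m<n⇒m%n≡m (>-nonZero⁻¹ n)

mod-injective : ∀ {m m'} n .{{_ : NonZero n}} → m mod n ≡ m' mod n → m % n ≡ m' % n
mod-injective {m} {m'} n eq = trans (sym (toℕ-mod m n)) (trans (cong toℕ eq) (toℕ-mod m' n))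

toℕ-mod-inverse : ∀ {n} .{{_ : NonZero n}} (a : Fin n) → toℕ a mod n ≡ a
toℕ-mod-inverse {n} a = toℕ-injective (trans (toℕ-mod (toℕ a) n) (m<n⇒m%n≡m (toℕ<n a)))

%-cong-+ : ∀ {a a' b b'} n .{{_ : NonZero n}} →
           a % n ≡ a' % n → b % n ≡ b' % n → (a + b) % n ≡ (a' + b') % n
%-cong-+ {a} {a'} {b} {b'} n ea eb = begin
  (a + b) % n             ≡⟨ %-distribˡ-+ a b n ⟩
  (a % n + b % n) % n     ≡⟨ cong₂ (λ x y → (x + y) % n) ea eb ⟩
  (a' % n + b' % n) % n   ≡⟨ %-distribˡ-+ a' b' n ⟨
  (a' + b') % n           ∎
  where open ≡-Reasoning

%-cong-* : ∀ {a a' b b'} n .{{_ : NonZero n}} →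
           a % n ≡ a' % n → b % n ≡ b' % n → (a * b) % n ≡ (a' * b') % n
%-cong-* {a} {a'} {b} {b'} n ea eb = begin
  (a * b) % n             ≡⟨ %-distribˡ-* a b n ⟩
  (a % n * (b % n)) % n   ≡⟨ cong₂ (λ x y → (x * y) % n) ea eb ⟩
  (a' % n * (b' % n)) % n ≡⟨ %-distribˡ-* a' b' n ⟨
  (a' * b') % n           ∎
  where open ≡-Reasoning

-- n ∸ a % n represents -a modulo n
n∣neg+self : ∀ n .{{_ : NonZero n}} a → n ∣ (n ∸ a % n) + a
n∣neg+self n a = m%n≡0⇒n∣m _ n (begin
  ((n ∸ a % n) + a) % n     ≡⟨ %-cong-+ n refl (sym (m%n%n≡m%n a n)) ⟩
  ((n ∸ a % n) + a % n) % n ≡⟨ cong (_% n) (m∸n+n≡m (m%n≤n a n)) ⟩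
  n % n                     ≡⟨ n%n≡0 n ⟩
  0                         ∎)
  where open ≡-Reasoning

+-neg-cancelʳ : ∀ n .{{_ : NonZero n}} x a → (x + (n ∸ a % n) + a) % n ≡ x % n
+-neg-cancelʳ n x a = trans (cong (_% n) (+-assoc x _ a)) (%-remove-+ʳ x (n∣neg+self n a))

m%2≡0⊎m%2≡1 : ∀ m → m % 2 ≡ 0 ⊎ m % 2 ≡ 1
m%2≡0⊎m%2≡1 m with m % 2 | m%n<n m 2
... | 0 | _ = inj₁ refl
... | 1 | _ = inj₂ refl
... | suc (suc _) | s≤s (s≤s ())

[m+n]%2≡0⇒m%2≡n%2 : ∀ a b → (a + b) % 2 ≡ 0 → a % 2 ≡ b % 2
[m+n]%2≡0⇒m%2≡n%2 a b a+b≡0 with m%2≡0⊎m%2≡1 a | m%2≡0⊎m%2≡1 b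
... | inj₁ a≡0 | inj₁ b≡0 = trans a≡0 (sym b≡0)
... | inj₂ a≡1 | inj₂ b≡1 = trans a≡1 (sym b≡1)
... | inj₁ a≡0 | inj₂ b≡1 = contradiction (trans (sym a+b≡0) (%-cong-+ {a} {0} {b} {1} 2 a≡0 b≡1)) λ ()
... | inj₂ a≡1 | inj₁ b≡0 = contradiction (trans (sym a+b≡0) (%-cong-+ {a} {1} {b} {0} 2 a≡1 b≡0)) λ ()

_⊕_ : Fin 2 → Fin 2 → Fin 2
zero     ⊕ c        = c
suc zero ⊕ zero     = suc zero
suc zero ⊕ suc zero = zero

toℕ-⊕ : ∀ c c' → (toℕ c + toℕ c') % 2 ≡ toℕ (c ⊕ c') % 2
toℕ-⊕ zero       zero       = refl
toℕ-⊕ zero       (suc zero) = refl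
toℕ-⊕ (suc zero) zero       = refl
toℕ-⊕ (suc zero) (suc zero) = refl

⊕-cancelʳ : ∀ c c' → (c ⊕ c') ⊕ c' ≡ c
⊕-cancelʳ zero       zero       = refl
⊕-cancelʳ zero       (suc zero) = refl
⊕-cancelʳ (suc zero) zero       = refl
⊕-cancelʳ (suc zero) (suc zero) = refl

-- Subsets of ℕ closed under sums and differences

module _ {Q : Pred ℕ 0ℓ} (Q? : Decidable Q) where

  NoneBetween0And : ℕ → Set
  NoneBetween0And m = ∀ {k} → 0 < k → k < m → ¬ Q k

  least-positive : ∀ {n} → 0 < n → Q n → ∃ λ m → 0 < m × Q m × NoneBetween0And m
  least-positive {n} 0<n qn = search (n ∸ 1) 1 (m∸n+n≡m 0<n) z<s λ { {suc _} _ (s≤s ()) }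
    where
    search : ∀ gap i → gap + i ≡ n → 0 < i → NoneBetween0And i →
             ∃ λ m → 0 < m × Q m × NoneBetween0And m
    search zero i refl 0<i none = i , 0<i , qn , none
    search (suc gap) i gap+i≡n 0<i none with Q? i
    ... | yes qi = i , 0<i , qi , none
    ... | no ¬qi = search gap (suc i) (trans (+-suc gap i) gap+i≡n) z<s none′
      where
      none′ : NoneBetween0And (suc i)
      none′ 0<k k<1+i with m<1+n⇒m<n∨m≡n k<1+i
      ... | inj₁ k<i  = none 0<k k<i
      ... | inj₂ refl = ¬qi

  -- Euclidean division by the least positive element m leaves a remainder
  -- in Q that is smaller than m, hence zero.
  multiples-of-least : ∀ n .{{_ : NonZero n}} → Q n →
    (∀ {x y} → Q x → Q y → Q (x + y)) → (∀ {x y} → Q (x + y) → Q y → Q x) →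
    ∃ λ m → m ∣ n × (∀ {x} → Q x → m ∣ x) × (∀ {x} → m ∣ x → Q x)
  multiples-of-least n qn +-closed ∸-closed with least-positive (>-nonZero⁻¹ n) qn
  ... | m , 0<m , qm , none-below = m , divides-all qn , divides-all , multiple-in
    where
    instance
      m≢0 : NonZero m
      m≢0 = >-nonZero 0<m

    multiple-in : ∀ {x} → m ∣ x → Q x
    multiple-in (divides q refl) = go q
      where
      go : ∀ q → Q (q * m)
      go zero    = ∸-closed qm qm
      go (suc q) = +-closed qm (go q)

    divides-all : ∀ {x} → Q x → m ∣ x
    divides-all {x} qx with x % m in x%m≡
    ... | zero  = m%n≡0⇒n∣m x m x%m≡
    ... | suc _ = contradiction (subst Q x%m≡ remainder-in) (none-below z<s (subst (_< m) x%m≡ (m%n<n x m)))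
      where
      remainder-in : Q (x % m)
      remainder-in = ∸-closed (subst Q (m≡m%n+[m/n]*n x m) qx) (multiple-in (divides (x / m) refl))

𝟙 : Bool → ℕ
𝟙 b = if b then 1 else 0

sum-tabulate : ∀ {n} (f : Fin n → ℕ) → sum (tabulate f) ≡ ∑[ i < n ] f i
sum-tabulate {zero}  f = refl
sum-tabulate {suc n} f = cong (f zero +_) (sum-tabulate (f ∘ suc))

sum-map-concatMap : ∀ {A B : Set} (f : B → ℕ) (g : A → List B) xs →
                    sum (map f (concatMap g xs)) ≡ sum (map (λ x → sum (map f (g x))) xs)
sum-map-concatMap f g []       = refl
sum-map-concatMap f g (x ∷ xs) = begin
  sum (map f (g x ++ concatMap g xs))                        ≡⟨ cong sum (map-++ f (g x) _) ⟩
  sum (map f (g x) ++ map f (concatMap g xs))                ≡⟨ sum-++ (map f (g x)) _ ⟩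
  sum (map f (g x)) + sum (map f (concatMap g xs))           ≡⟨ cong (_ +_) (sum-map-concatMap f g xs) ⟩
  sum (map f (g x)) + sum (map (λ x → sum (map f (g x))) xs) ∎
  where open ≡-Reasoning

sum-map-concatMap-allFin : ∀ {B : Set} {n} (f : B → ℕ) (g : Fin n → List B) →
                           sum (map f (concatMap g (allFin n))) ≡ ∑[ i < n ] sum (map f (g i))
sum-map-concatMap-allFin {n = n} f g =
  trans (sum-map-concatMap f g (allFin n))
        (trans (cong sum (map-tabulate id (λ i → sum (map f (g i))))) (sum-tabulate (λ i → sum (map f (g i)))))

∑-𝟙-none : ∀ {n} (g : Fin n → Bool) → (∀ a → g a ≡ false) → ∑[ a < n ] 𝟙 (g a) ≡ 0
∑-𝟙-none {zero}  g none = refl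
∑-𝟙-none {suc n} g none rewrite none zero = ∑-𝟙-none (g ∘ suc) (none ∘ suc)

∑-𝟙-unique : ∀ {n} (g : Fin n → Bool) → (∀ {a a'} → g a ≡ true → g a' ≡ true → a ≡ a') →
             ∀ {a₀} → g a₀ ≡ true → ∑[ a < n ] 𝟙 (g a) ≡ 1
∑-𝟙-unique {suc n} g unique {zero} ga₀ rewrite ga₀ =
  cong suc (∑-𝟙-none (g ∘ suc) λ a → Bool.¬-not λ gsa → contradiction (unique ga₀ gsa) λ ())
∑-𝟙-unique {suc n} g unique {suc a₀} ga₀ with g zero in g0
... | true  = contradiction (unique g0 ga₀) λ ()
... | false = ∑-𝟙-unique (g ∘ suc) (λ x y → Finₚ.suc-injective (unique x y)) ga₀

∑-0-or-K : ∀ {n K} (f : Fin n → ℕ) → (∀ i → f i ≡ 0 ⊎ f i ≡ K) →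
           ∃ λ t → t ≤ n × ∑[ i < n ] f i ≡ t * K
∑-0-or-K {zero}  f _       = 0 , z≤n , refl
∑-0-or-K {suc n} f f0orK with ∑-0-or-K (f ∘ suc) (f0orK ∘ suc) | f0orK zero
... | t , t≤n , ∑≡ | inj₁ f0≡0 = t , m≤n⇒m≤1+n t≤n , cong₂ _+_ f0≡0 ∑≡
... | t , t≤n , ∑≡ | inj₂ f0≡K = suc t , s≤s t≤n , cong₂ _+_ f0≡K ∑≡

≤-∑ : ∀ {n} (f : Fin n → ℕ) i → f i ≤ ∑[ i < n ] f i
≤-∑ f zero    = m≤m+n _ _
≤-∑ f (suc i) = ≤-trans (≤-∑ (f ∘ suc) i) (m≤n+m _ _)

quotient-positive : ∀ {m n} .{{_ : NonZero n}} (m∣n : m ∣ n) → 0 < _∣_.quotient m∣n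
quotient-positive {n = suc _} (divides (suc _) _) = z<s

quotient-unique : ∀ {m n} .{{_ : NonZero m}} (x y : m ∣ n) → _∣_.quotient x ≡ _∣_.quotient y
quotient-unique {m} (divides q n≡q*m) (divides q' n≡q'*m) = *-cancelʳ-≡ q q' m (trans (sym n≡q*m) n≡q'*m)

2<odd-prime : ∀ {p} → Prime p → ¬ p ≡ 2 → 2 < p
2<odd-prime {p} p-prime p≢2 = ≤∧≢⇒< (nonTrivial⇒n>1 p ⦃ prime⇒nonTrivial p-prime ⦄) (p≢2 ∘ sym)

-- Powers of s modulo p

module Powers (p r s : ℕ) .{{_ : NonZero p}} .{{_ : NonZero r}} (sʳ≡1 : s ^ r % p ≡ 1) where

  1%p≡1 : 1 % p ≡ 1
  1%p≡1 = trans (cong (_% p) (sym sʳ≡1)) (trans (m%n%n≡m%n (s ^ r) p) sʳ≡1)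

  s^-periodic : ∀ x q → s ^ (x + q * r) % p ≡ s ^ x % p
  s^-periodic x zero    = cong (λ e → s ^ e % p) (+-identityʳ x)
  s^-periodic x (suc q) = begin
    s ^ (x + (r + q * r)) % p     ≡⟨ cong (λ e → s ^ e % p) (+-comm-middle x r (q * r)) ⟩
    s ^ (x + q * r + r) % p       ≡⟨ cong (_% p) (^-distribˡ-+-* s (x + q * r) r) ⟩
    s ^ (x + q * r) * s ^ r % p   ≡⟨ %-cong-* {s ^ (x + q * r)} p refl (trans sʳ≡1 (sym 1%p≡1)) ⟩
    s ^ (x + q * r) * 1 % p       ≡⟨ cong (_% p) (*-identityʳ _) ⟩
    s ^ (x + q * r) % p           ≡⟨ s^-periodic x q ⟩
    s ^ x % p                     ∎
    where
    open ≡-Reasoning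
    +-comm-middle : ∀ a b c → a + (b + c) ≡ a + c + b
    +-comm-middle = solve-∀

  s^-mod : ∀ b → s ^ (b % r) % p ≡ s ^ b % p
  s^-mod b = trans (sym (s^-periodic (b % r) (b / r))) (cong (λ e → s ^ e % p) (sym (m≡m%n+[m/n]*n b r)))

  p∤s^ : ∀ {k} → k ≤ r → ¬ p ∣ s ^ k
  p∤s^ {k} k≤r p∣s^k = contradiction (trans (sym sʳ≡1) (n∣m⇒m%n≡0 (s ^ r) p p∣s^r)) λ ()
    where
    p∣s^r : p ∣ s ^ r
    p∣s^r = subst (p ∣_) (trans (sym (^-distribˡ-+-* s k (r ∸ k))) (cong (s ^_) (m+[n∸m]≡n k≤r)))
                  (∣-trans p∣s^k (m∣m*n (s ^ (r ∸ k))))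

  s^-collision : ∀ {i k} → i < k → k < r → s ^ i % p ≡ s ^ k % p → s ^ (k ∸ i) % p ≡ 1
  s^-collision {i} {k} i<k k<r s^i≡s^k = begin
    s ^ (k ∸ i) % p               ≡⟨ s^-periodic (k ∸ i) 1 ⟨
    s ^ (k ∸ i + 1 * r) % p       ≡⟨ cong (λ e → s ^ e % p) exponent ⟩
    s ^ (k + (r ∸ i)) % p         ≡⟨ cong (_% p) (^-distribˡ-+-* s k (r ∸ i)) ⟩
    s ^ k * s ^ (r ∸ i) % p       ≡⟨ %-cong-* {s ^ k} p (sym s^i≡s^k) refl ⟩
    s ^ i * s ^ (r ∸ i) % p       ≡⟨ cong (_% p) (^-distribˡ-+-* s i (r ∸ i)) ⟨
    s ^ (i + (r ∸ i)) % p         ≡⟨ cong (λ e → s ^ e % p) (m+[n∸m]≡n i≤r) ⟩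
    s ^ r % p                     ≡⟨ sʳ≡1 ⟩
    1                             ∎
    where
    open ≡-Reasoning
    i≤r : i ≤ r
    i≤r = <⇒≤ (<-trans i<k k<r)
    exponent : k ∸ i + 1 * r ≡ k + (r ∸ i)
    exponent = begin
      k ∸ i + 1 * r   ≡⟨ cong (k ∸ i +_) (*-identityˡ r) ⟩
      k ∸ i + r       ≡⟨ +-∸-comm r (<⇒≤ i<k) ⟨
      k + r ∸ i       ≡⟨ +-∸-assoc k i≤r ⟩
      k + (r ∸ i)     ∎

  -- 0, s⁰, …, s^(r-1) are r + 1 distinct residues modulo p.
  order<modulus : (∀ k → 0 < k → k < r → ¬ (s ^ k % p ≡ 1)) → r < p
  order<modulus minimal with p ℕ.≤? r
  ... | no p≰r  = ≰⇒> p≰r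
  ... | yes p≤r = ⊥-elim (distinct (pigeonhole (s≤s p≤r) residue))
    where
    residue : Fin (suc r) → Fin p
    residue zero    = 0 mod p
    residue (suc k) = s ^ toℕ k mod p

    distinct : ¬ ∃ λ i → ∃ λ k → i Fin.< k × residue i ≡ residue k
    distinct (zero  , suc k , _   , eq) =
      p∤s^ (<⇒≤ (toℕ<n k)) (m%n≡0⇒n∣m _ p (trans (sym (mod-injective p eq)) (0%n≡0 p)))
    distinct (suc i , suc k , i<k , eq) =
      minimal (toℕ k ∸ toℕ i) (m<n⇒0<n∸m (s<s⁻¹ i<k)) (≤-<-trans (m∸n≤m (toℕ k) (toℕ i)) (toℕ<n k))
        (s^-collision (s<s⁻¹ i<k) (toℕ<n k) (mod-injective p eq))

-- The group G in coordinates

module Coordinates (p r s : ℕ) {{_ : NonZero p}} {{_ : NonZero r}} (sʳ≡1 : s ^ r % p ≡ 1) where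

  open G p r s public
  open Powers p r s sʳ≡1 public

  ⟨⟩-cong : ∀ {a a' : Fin p} {b b' : Fin r} {c c' : Fin 2} →
            a ≡ a' → b ≡ b' → c ≡ c' → ⟨ a , b , c ⟩ ≡ ⟨ a' , b' , c' ⟩
  ⟨⟩-cong refl refl refl = refl

  -- Opaque, so that unification sees the exponents rather than their residues.
  opaque
    infix 25 σ^_τ^_j^_
    σ^_τ^_j^_ : ℕ → ℕ → ℕ → El
    σ^ a τ^ b j^ c = ⟨ a mod p , b mod r , c mod 2 ⟩

    σ^τ^j^-unfold : ∀ a b c → σ^ a τ^ b j^ c ≡ ⟨ a mod p , b mod r , c mod 2 ⟩
    σ^τ^j^-unfold a b c = refl

  σ^τ^j^-cong : ∀ {a b c a' b' c'} → a % p ≡ a' % p → b % r ≡ b' % r → c % 2 ≡ c' % 2 →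
                σ^ a τ^ b j^ c ≡ σ^ a' τ^ b' j^ c'
  σ^τ^j^-cong {a} {b} {c} {a'} {b'} {c'} ea eb ec = begin
    σ^ a τ^ b j^ c                       ≡⟨ σ^τ^j^-unfold a b c ⟩
    ⟨ a mod p , b mod r , c mod 2 ⟩      ≡⟨ ⟨⟩-cong (mod-cong {a} {a'} p ea) (mod-cong {b} {b'} r eb) (mod-cong {c} {c'} 2 ec) ⟩
    ⟨ a' mod p , b' mod r , c' mod 2 ⟩   ≡⟨ σ^τ^j^-unfold a' b' c' ⟨
    σ^ a' τ^ b' j^ c'                    ∎
    where open ≡-Reasoning

  σ^τ^j^-η : ∀ a b c → ⟨ a , b , c ⟩ ≡ σ^ toℕ a τ^ toℕ b j^ toℕ c
  σ^τ^j^-η a b c =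
    trans (sym (⟨⟩-cong (toℕ-mod-inverse a) (toℕ-mod-inverse b) (toℕ-mod-inverse c))) (sym (σ^τ^j^-unfold _ _ _))

  σ^τ^j^-· : ∀ a b c a' b' c' →
             σ^ a τ^ b j^ c · σ^ a' τ^ b' j^ c' ≡ σ^ (a + s ^ b * a') τ^ (b + b') j^ (c + c')
  σ^τ^j^-· a b c a' b' c' = begin
    σ^ a τ^ b j^ c · σ^ a' τ^ b' j^ c'    ≡⟨ cong₂ _·_ (σ^τ^j^-unfold a b c) (σ^τ^j^-unfold a' b' c') ⟩
    ⟨ A mod p , B mod r , C mod 2 ⟩       ≡⟨ σ^τ^j^-unfold A B C ⟨
    σ^ A τ^ B j^ C                        ≡⟨ σ^τ^j^-cong
      (%-cong-+ p (toℕ-mod-% a p)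
        (%-cong-* p (trans (cong (λ e → s ^ e % p) (toℕ-mod b r)) (s^-mod b)) (toℕ-mod-% a' p)))
      (%-cong-+ r (toℕ-mod-% b r) (toℕ-mod-% b' r))
      (%-cong-+ {toℕ (c mod 2)} {c} {toℕ (c' mod 2)} {c'} 2 (toℕ-mod-% c 2) (toℕ-mod-% c' 2)) ⟩
    σ^ (a + s ^ b * a') τ^ (b + b') j^ (c + c') ∎
    where
    open ≡-Reasoning
    A = toℕ (a mod p) + s ^ toℕ (b mod r) * toℕ (a' mod p)
    B = toℕ (b mod r) + toℕ (b' mod r)
    C = toℕ (c mod 2) + toℕ (c' mod 2)

  σ^τ^j^-inv : ∀ a b c →
               inv (σ^ a τ^ b j^ c) ≡ σ^ ((p ∸ a % p) * s ^ (r ∸ b % r)) τ^ (r ∸ b % r) j^ c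
  σ^τ^j^-inv a b c = begin
    inv (σ^ a τ^ b j^ c)                  ≡⟨ cong inv (σ^τ^j^-unfold a b c) ⟩
    ⟨ A mod p , B mod r , c mod 2 ⟩       ≡⟨ σ^τ^j^-unfold A B c ⟨
    σ^ A τ^ B j^ c
      ≡⟨ σ^τ^j^-cong (cong₂ (λ x y → (p ∸ x) * s ^ (r ∸ y) % p) (toℕ-mod a p) (toℕ-mod b r))
                     (cong (λ y → (r ∸ y) % r) (toℕ-mod b r)) refl ⟩
    σ^ ((p ∸ a % p) * s ^ (r ∸ b % r)) τ^ (r ∸ b % r) j^ c ∎
    where
    open ≡-Reasoning
    A = (p ∸ toℕ (a mod p)) * s ^ (r ∸ toℕ (b mod r))
    B = r ∸ toℕ (b mod r)

  ε≡ : ε ≡ σ^ 0 τ^ 0 j^ 0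
  ε≡ = sym (σ^τ^j^-unfold 0 0 0)

  σ≡ : σ ≡ σ^ 1 τ^ 0 j^ 0
  σ≡ = sym (σ^τ^j^-unfold 1 0 0)

  τ≡ : τ ≡ σ^ 0 τ^ 1 j^ 0
  τ≡ = sym (σ^τ^j^-unfold 0 1 0)

  j≡ : j ≡ σ^ 0 τ^ 0 j^ 1
  j≡ = sym (σ^τ^j^-unfold 0 0 1)

  σ^-· : ∀ k a b c → σ^ k τ^ 0 j^ 0 · σ^ a τ^ b j^ c ≡ σ^ (k + a) τ^ b j^ c
  σ^-· k a b c = trans (σ^τ^j^-· k 0 0 a b c) (σ^τ^j^-cong (cong (λ x → (k + x) % p) (+-identityʳ a)) refl refl)

  σ-pow : ∀ n → pow σ n ≡ σ^ n τ^ 0 j^ 0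
  σ-pow zero    = ε≡
  σ-pow (suc n) = begin
    σ · pow σ n                         ≡⟨ cong₂ _·_ σ≡ (σ-pow n) ⟩
    σ^ 1 τ^ 0 j^ 0 · σ^ n τ^ 0 j^ 0      ≡⟨ σ^-· 1 n 0 0 ⟩
    σ^ suc n τ^ 0 j^ 0                   ∎
    where open ≡-Reasoning

  τ^j^-pow : ∀ m c n → pow (σ^ 0 τ^ m j^ c) n ≡ σ^ 0 τ^ (n * m) j^ (n * c)
  τ^j^-pow m c zero    = ε≡
  τ^j^-pow m c (suc n) = begin
    σ^ 0 τ^ m j^ c · pow (σ^ 0 τ^ m j^ c) n        ≡⟨ cong (σ^ 0 τ^ m j^ c ·_) (τ^j^-pow m c n) ⟩
    σ^ 0 τ^ m j^ c · σ^ 0 τ^ (n * m) j^ (n * c)    ≡⟨ σ^τ^j^-· 0 m c 0 (n * m) (n * c) ⟩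
    σ^ (s ^ m * 0) τ^ (m + n * m) j^ (c + n * c)   ≡⟨ σ^τ^j^-cong (cong (_% p) (*-zeroʳ (s ^ m))) refl refl ⟩
    σ^ 0 τ^ (m + n * m) j^ (c + n * c)             ∎
    where open ≡-Reasoning

  τ-pow : ∀ n → pow τ n ≡ σ^ 0 τ^ n j^ 0
  τ-pow n = begin
    pow τ n                         ≡⟨ cong (λ g → pow g n) τ≡ ⟩
    pow (σ^ 0 τ^ 1 j^ 0) n          ≡⟨ τ^j^-pow 1 0 n ⟩
    σ^ 0 τ^ (n * 1) j^ (n * 0)      ≡⟨ σ^τ^j^-cong refl (cong (_% r) (*-identityʳ n)) (cong (_% 2) (*-zeroʳ n)) ⟩
    σ^ 0 τ^ n j^ 0                  ∎
    where open ≡-Reasoning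

  τ^·j : ∀ m → pow τ m · j ≡ σ^ 0 τ^ m j^ 1
  τ^·j m = begin
    pow τ m · j                     ≡⟨ cong₂ _·_ (τ-pow m) j≡ ⟩
    σ^ 0 τ^ m j^ 0 · σ^ 0 τ^ 0 j^ 1  ≡⟨ σ^τ^j^-· 0 m 0 0 0 1 ⟩
    σ^ (s ^ m * 0) τ^ (m + 0) j^ 1   ≡⟨ σ^τ^j^-cong (cong (_% p) (*-zeroʳ (s ^ m))) (cong (_% r) (+-identityʳ m)) refl ⟩
    σ^ 0 τ^ m j^ 1                  ∎
    where open ≡-Reasoning

  ·-inv : ∀ a b c a' b' c' → σ^ a τ^ b j^ c · inv (σ^ a' τ^ b' j^ c') ≡
          σ^ (a + s ^ b * ((p ∸ a' % p) * s ^ (r ∸ b' % r))) τ^ (b + (r ∸ b' % r)) j^ (c + c')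
  ·-inv a b c a' b' c' = trans (cong (σ^ a τ^ b j^ c ·_) (σ^τ^j^-inv a' b' c')) (σ^τ^j^-· _ _ _ _ _ _)

  ·-inv-same-τ : ∀ a b c a' b' c' → b % r ≡ b' % r →
                 σ^ a τ^ b j^ c · inv (σ^ a' τ^ b' j^ c') ≡ σ^ (a + (p ∸ a' % p)) τ^ 0 j^ (c + c')
  ·-inv-same-τ a b c a' b' c' b≡b' =
    trans (·-inv a b c a' b' c') (σ^τ^j^-cong (%-cong-+ p refl σ-part) (trans τ-part (sym (0%n≡0 r))) refl)
    where
    open ≡-Reasoning
    B = r ∸ b' % r
    q = p ∸ a' % p
    τ-part : (b + B) % r ≡ 0
    τ-part = begin
      (b + B) % r    ≡⟨ %-cong-+ r b≡b' refl ⟩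
      (b' + B) % r   ≡⟨ cong (_% r) (+-comm b' B) ⟩
      (B + b') % r   ≡⟨ n∣m⇒m%n≡0 _ r (n∣neg+self r b') ⟩
      0              ∎
    σ-part : s ^ b * (q * s ^ B) % p ≡ q % p
    σ-part = begin
      s ^ b * (q * s ^ B) % p       ≡⟨ cong (_% p) (*-comm-middle (s ^ b) q (s ^ B)) ⟩
      q * (s ^ b * s ^ B) % p       ≡⟨ cong (λ x → q * x % p) (^-distribˡ-+-* s b B) ⟨
      q * s ^ (b + B) % p           ≡⟨ %-cong-* {q} p refl (trans (sym (s^-mod (b + B))) (cong (λ e → s ^ e % p) τ-part)) ⟩
      q * 1 % p                     ≡⟨ cong (_% p) (*-identityʳ q) ⟩
      q % p                         ∎
      where
      *-comm-middle : ∀ x y z → x * (y * z) ≡ y * (x * z)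
      *-comm-middle = solve-∀

  pow-generated : ∀ {gens y} n → ⟨ gens ⟩∋ y → ⟨ gens ⟩∋ pow y n
  pow-generated zero    _ = one
  pow-generated (suc n) u = mul u (pow-generated n u)

  module Membership (H : Subgroup) where

    ∈-resp-≡ : ∀ {x y} → x ≡ y → x ∈S H → y ∈S H
    ∈-resp-≡ = subst (_∈S H)

    pow∈ : ∀ {g} n → g ∈S H → pow g n ∈S H
    pow∈ zero    g∈H = ε∈ H
    pow∈ (suc n) g∈H = ·∈ H _ _ g∈H (pow∈ n g∈H)

    ·-inv∈ : ∀ {x y} → x ∈S H → y ∈S H → (x · inv y) ∈S H
    ·-inv∈ x∈H y∈H = ·∈ H _ _ x∈H (inv∈ H _ y∈H)

    generated⊆ : ∀ {gens x} → (∀ {g} → g ∈ gens → g ∈S H) → ⟨ gens ⟩∋ x → x ∈S H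
    generated⊆ gens⊆H (gen g∈gens) = gens⊆H g∈gens
    generated⊆ gens⊆H one          = ε∈ H
    generated⊆ gens⊆H (mul u v)    = ·∈ H _ _ (generated⊆ gens⊆H u) (generated⊆ gens⊆H v)
    generated⊆ gens⊆H (neg u)      = inv∈ H _ (generated⊆ gens⊆H u)

    module Containingσ (σ∈H : σ ∈S H) where

      σ-shift : ∀ {a b c} a' → σ^ a τ^ b j^ c ∈S H → σ^ a' τ^ b j^ c ∈S H
      σ-shift {a} {b} {c} a' x∈H = ∈-resp-≡ shifted (·∈ H _ _ (pow∈ k σ∈H) x∈H)
        where
        k = a' + (p ∸ a % p)
        shifted : pow σ k · σ^ a τ^ b j^ c ≡ σ^ a' τ^ b j^ c
        shifted = begin
          pow σ k · σ^ a τ^ b j^ c           ≡⟨ cong (_· σ^ a τ^ b j^ c) (σ-pow k) ⟩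
          σ^ k τ^ 0 j^ 0 · σ^ a τ^ b j^ c    ≡⟨ σ^-· k a b c ⟩
          σ^ (k + a) τ^ b j^ c               ≡⟨ σ^τ^j^-cong (+-neg-cancelʳ p a' a) refl refl ⟩
          σ^ a' τ^ b j^ c                    ∎
          where open ≡-Reasoning

      module Avoidingj (j∉H : ¬ j ∈S H) where

        j-exponent-unique : ∀ {a b c a' b' c'} → σ^ a τ^ b j^ c ∈S H → σ^ a' τ^ b' j^ c' ∈S H →
                            b % r ≡ b' % r → c % 2 ≡ c' % 2
        j-exponent-unique {a} {b} {c} {a'} {b'} {c'} x∈H y∈H b≡b' with m%2≡0⊎m%2≡1 (c + c')
        ... | inj₁ c+c'≡0 = [m+n]%2≡0⇒m%2≡n%2 c c' c+c'≡0
        ... | inj₂ c+c'≡1 = contradiction (∈-resp-≡ (trans (σ^τ^j^-cong refl refl c+c'≡1) (sym j≡)) j^[c+c']∈H) j∉H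
          where
          j^[c+c']∈H : σ^ 0 τ^ 0 j^ (c + c') ∈S H
          j^[c+c']∈H = σ-shift 0 (∈-resp-≡ (·-inv-same-τ a b c a' b' c' b≡b') (·-inv∈ x∈H y∈H))

        -- (τ^m j)^e = τ^r j^e = j^e lies in H together with ε = j⁰.
        τ^j-period-even : ∀ {m e} → σ^ 0 τ^ m j^ 1 ∈S H → r ≡ m * e → 2 ∣ e
        τ^j-period-even {m} {e} g∈H r≡m*e =
          m%n≡0⇒n∣m e 2 (sym (trans (j-exponent-unique (∈-resp-≡ ε≡ (ε∈ H)) gᵉ∈H τ-exponents)
                                    (cong (_% 2) (*-identityʳ e))))
          where
          gᵉ∈H : σ^ 0 τ^ (e * m) j^ (e * 1) ∈S H
          gᵉ∈H = ∈-resp-≡ (τ^j^-pow m 1 e) (pow∈ e g∈H)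
          τ-exponents : 0 % r ≡ e * m % r
          τ-exponents = trans (0%n≡0 r) (sym (trans (cong (_% r) (trans (*-comm e m) (sym r≡m*e))) (n%n≡0 r)))

  module σ-Exponents (H : Subgroup) where
    open Membership H

    σ-exponent : ℕ → Set
    σ-exponent x = σ^ x τ^ 0 j^ 0 ∈S H

    σ-exponent? : Decidable σ-exponent
    σ-exponent? x = mem H (σ^ x τ^ 0 j^ 0) Bool.≟ true

    σ-exponent-+ : ∀ {x y} → σ-exponent x → σ-exponent y → σ-exponent (x + y)
    σ-exponent-+ {x} {y} x∈ y∈ = ∈-resp-≡ (σ^-· x y 0 0) (·∈ H _ _ x∈ y∈)

    σ-exponent-∸ : ∀ {x y} → σ-exponent (x + y) → σ-exponent y → σ-exponent x
    σ-exponent-∸ {x} {y} x+y∈ y∈ = ∈-resp-≡ (trans (·-inv-same-τ (x + y) 0 0 y 0 0 refl)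
                                                    (σ^τ^j^-cong exponent refl refl))
                                            (·-inv∈ x+y∈ y∈)
      where
      exponent : (x + y + (p ∸ y % p)) % p ≡ x % p
      exponent = trans (cong (_% p) (+-comm-right x y (p ∸ y % p))) (+-neg-cancelʳ p x y)
        where
        +-comm-right : ∀ a b c → a + b + c ≡ a + c + b
        +-comm-right = solve-∀

    σ-exponent-p : σ-exponent p
    σ-exponent-p = ∈-resp-≡ (trans ε≡ (σ^τ^j^-cong (trans (0%n≡0 p) (sym (n%n≡0 p))) refl refl)) (ε∈ H)

    σ∈⊎σ-exponents-trivial : Prime p → σ ∈S H ⊎ (∀ {x} → σ-exponent x → p ∣ x)
    σ∈⊎σ-exponents-trivial p-prime
      with multiples-of-least σ-exponent? p σ-exponent-p σ-exponent-+ σ-exponent-∸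
    ... | m , m∣p , divides-all , multiple-in with prime⇒irreducible p-prime m∣p
    ...   | inj₁ refl = inj₁ (∈-resp-≡ (sym σ≡) (multiple-in (divides 1 refl)))
    ...   | inj₂ refl = inj₂ divides-all

    module Counting (σ-exponents-trivial : ∀ {x} → σ-exponent x → p ∣ x) where

      Occupied : ℕ → ℕ → Set
      Occupied b c = ∃ λ (a : Fin p) → σ^ toℕ a τ^ b j^ c ∈S H

      occupied? : ∀ b c → Dec (Occupied b c)
      occupied? b c = any? λ a → mem H (σ^ toℕ a τ^ b j^ c) Bool.≟ true

      occupied : ∀ {a b c} → σ^ a τ^ b j^ c ∈S H → Occupied b c
      occupied {a} x∈H = a mod p , ∈-resp-≡ (σ^τ^j^-cong (sym (toℕ-mod-% a p)) refl refl) x∈H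

      occupied-cong : ∀ {b c b' c'} → b % r ≡ b' % r → c % 2 ≡ c' % 2 → Occupied b c → Occupied b' c'
      occupied-cong eb ec (a , x∈H) = a , ∈-resp-≡ (σ^τ^j^-cong refl eb ec) x∈H

      occupied-∸ : ∀ {b c c'} → Occupied b c → Occupied b c' → Occupied 0 (c + c')
      occupied-∸ {b} {c} {c'} (a , x∈H) (a' , y∈H) =
        occupied (∈-resp-≡ (·-inv-same-τ (toℕ a) b c (toℕ a') b c' refl) (·-inv∈ x∈H y∈H))

      occupied-+ : ∀ {b c c'} → Occupied 0 c → Occupied b c' → Occupied b (c + c')
      occupied-+ {b} {c} {c'} (a , x∈H) (a' , y∈H) =
        occupied (∈-resp-≡ (σ^τ^j^-· (toℕ a) 0 c (toℕ a') b c') (·∈ H _ _ x∈H y∈H))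

      σ-exponent-unique : ∀ {a a' b c} → ⟨ a , b , c ⟩ ∈S H → ⟨ a' , b , c ⟩ ∈S H → a ≡ a'
      σ-exponent-unique {a} {a'} {b} {c} x∈H y∈H =
        toℕ-injective (trans (sym (m<n⇒m%n≡m (toℕ<n a))) (trans a≡a' (m<n⇒m%n≡m (toℕ<n a'))))
        where
        A = toℕ a
        A' = toℕ a'
        C = toℕ c
        C+C≡0 : (C + C) % 2 ≡ 0 % 2
        C+C≡0 = trans (cong (_% 2) (+-*2 C)) (m*n%n≡0 C 2)
          where
          +-*2 : ∀ x → x + x ≡ x * 2
          +-*2 = solve-∀
        quotient∈H : σ-exponent (A + (p ∸ A' % p))
        quotient∈H = ∈-resp-≡ (trans (·-inv-same-τ A (toℕ b) C A' (toℕ b) C refl) (σ^τ^j^-cong refl refl C+C≡0))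
                              (·-inv∈ (∈-resp-≡ (σ^τ^j^-η a b c) x∈H) (∈-resp-≡ (σ^τ^j^-η a' b c) y∈H))
        a≡a' : A % p ≡ A' % p
        a≡a' = trans (sym (+-neg-cancelʳ p A A')) (%-remove-+ˡ A' (σ-exponents-trivial quotient∈H))

      layer : Fin r → Fin 2 → ℕ
      layer b c = ∑[ a < p ] 𝟙 (mem H ⟨ a , b , c ⟩)

      layer-occupied : ∀ b c → Occupied (toℕ b) (toℕ c) → layer b c ≡ 1
      layer-occupied b c (a , x∈H) =
        ∑-𝟙-unique (λ a → mem H ⟨ a , b , c ⟩) σ-exponent-unique (∈-resp-≡ (sym (σ^τ^j^-η a b c)) x∈H)

      layer-unoccupied : ∀ b c → ¬ Occupied (toℕ b) (toℕ c) → layer b c ≡ 0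
      layer-unoccupied b c unoccupied = ∑-𝟙-none (λ a → mem H ⟨ a , b , c ⟩)
        λ a → Bool.¬-not λ x∈H → unoccupied (a , ∈-resp-≡ (σ^τ^j^-η a b c) x∈H)

      layer-cong : ∀ {b c b' c'} → (Occupied (toℕ b) (toℕ c) → Occupied (toℕ b') (toℕ c')) →
                   (Occupied (toℕ b') (toℕ c') → Occupied (toℕ b) (toℕ c)) → layer b c ≡ layer b' c'
      layer-cong {b} {c} {b'} {c'} to from with occupied? (toℕ b) (toℕ c)
      ... | yes occ = trans (layer-occupied b c occ) (sym (layer-occupied b' c' (to occ)))
      ... | no unocc = trans (layer-unoccupied b c unocc) (sym (layer-unoccupied b' c' (unocc ∘ from)))

      layer≤1 : ∀ b c → layer b c ≤ 1
      layer≤1 b c with occupied? (toℕ b) (toℕ c)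
      ... | yes occ  = ≤-reflexive (layer-occupied b c occ)
      ... | no unocc = ≤-trans (≤-reflexive (layer-unoccupied b c unocc)) z≤n

      b₀ : Fin r
      b₀ = 0 mod r

      -- Multiplying by (resp. dividing by) an element of the row b carries
      -- the row b₀ onto it and back, with the j-exponents shifted by c₀.
      layer-translate : ∀ {b} {c₀ : Fin 2} → Occupied (toℕ b) (toℕ c₀) → ∀ c → layer b c ≡ layer b₀ (c ⊕ c₀)
      layer-translate {b} {c₀} occ₀ c = layer-cong to from
        where
        to : Occupied (toℕ b) (toℕ c) → Occupied (toℕ b₀) (toℕ (c ⊕ c₀))
        to occ = occupied-cong (sym (toℕ-mod-% 0 r)) (toℕ-⊕ c c₀) (occupied-∸ occ occ₀)
        from : Occupied (toℕ b₀) (toℕ (c ⊕ c₀)) → Occupied (toℕ b) (toℕ c)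
        from occ = occupied-cong refl (trans (toℕ-⊕ (c ⊕ c₀) c₀) (cong (λ x → toℕ x % 2) (⊕-cancelʳ c c₀)))
                     (occupied-+ (occupied-cong {c' = toℕ (c ⊕ c₀)} (toℕ-mod-% 0 r) refl occ) occ₀)

      row : Fin r → ℕ
      row b = ∑[ c < 2 ] layer b c

      row-translate : ∀ {b} {c₀ : Fin 2} → Occupied (toℕ b) (toℕ c₀) → row b ≡ row b₀
      row-translate {c₀ = zero} occ₀ =
        cong₂ (λ x y → x + (y + 0)) (layer-translate occ₀ zero) (layer-translate occ₀ (suc zero))
      row-translate {c₀ = suc zero} occ₀ =
        trans (cong₂ (λ x y → x + (y + 0)) (layer-translate occ₀ zero) (layer-translate occ₀ (suc zero)))
              (swap (layer b₀ (suc zero)) (layer b₀ zero))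
        where
        swap : ∀ x y → x + (y + 0) ≡ y + (x + 0)
        swap = solve-∀

      row≡0⊎row-b₀ : ∀ b → row b ≡ 0 ⊎ row b ≡ row b₀
      row≡0⊎row-b₀ b with any? (λ c → occupied? (toℕ b) (toℕ c))
      ... | yes (c₀ , occ₀) = inj₂ (row-translate occ₀)
      ... | no unoccupied   = inj₁ (cong₂ (λ x y → x + (y + 0))
                                    (layer-unoccupied b zero (unoccupied ∘ (zero ,_)))
                                    (layer-unoccupied b (suc zero) (unoccupied ∘ (suc zero ,_))))

      0<row-b₀ : 0 < row b₀
      0<row-b₀ = ≤-trans (≤-reflexive (sym (layer-occupied b₀ zero ε-occupied))) (m≤m+n _ _)
        where
        ε-occupied : Occupied (toℕ b₀) 0
        ε-occupied = occupied-cong (sym (toℕ-mod-% 0 r)) refl (occupied (∈-resp-≡ ε≡ (ε∈ H)))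

      row-b₀≤2 : row b₀ ≤ 2
      row-b₀≤2 = +-mono-≤ (layer≤1 b₀ zero) (+-mono-≤ (layer≤1 b₀ (suc zero)) z≤n)

      card≡∑row : card H ≡ ∑[ b < r ] row b
      card≡∑row = begin
        card H
          ≡⟨ sum-map-concatMap-allFin f (λ a → concatMap (λ b → map (λ c → ⟨ a , b , c ⟩) (allFin 2)) (allFin r)) ⟩
        ∑[ a < p ] sum (map f (concatMap (λ b → map (λ c → ⟨ a , b , c ⟩) (allFin 2)) (allFin r)))
          ≡⟨ sum-cong-≗ (λ a → sum-map-concatMap-allFin f (λ b → map (λ c → ⟨ a , b , c ⟩) (allFin 2))) ⟩
        ∑[ a < p ] ∑[ b < r ] ∑[ c < 2 ] 𝟙 (mem H ⟨ a , b , c ⟩)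
          ≡⟨ ∑-comm (λ a b → ∑[ c < 2 ] 𝟙 (mem H ⟨ a , b , c ⟩)) ⟩
        ∑[ b < r ] ∑[ a < p ] ∑[ c < 2 ] 𝟙 (mem H ⟨ a , b , c ⟩)
          ≡⟨ sum-cong-≗ (λ b → ∑-comm (λ a c → 𝟙 (mem H ⟨ a , b , c ⟩))) ⟩
        ∑[ b < r ] row b
          ∎
        where
        open ≡-Reasoning
        f : El → ℕ
        f x = 𝟙 (mem H x)

      -- #H = t · #(row b₀) with 0 < t ≤ r < p and 0 < #(row b₀) ≤ 2 < p.
      p∤card : Prime p → ¬ p ≡ 2 → r < p → ¬ p ∣ card H
      p∤card p-prime p≢2 r<p p∣card with ∑-0-or-K row row≡0⊎row-b₀
      ... | zero , _ , ∑row≡0 = <⇒≱ 0<row-b₀ (≤-trans (≤-∑ row b₀) (≤-reflexive ∑row≡0))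
      ... | t@(suc _) , t≤r , ∑row≡
        with euclidsLemma t (row b₀) p-prime (subst (p ∣_) (trans card≡∑row ∑row≡) p∣card)
      ...   | inj₁ p∣t   = >⇒∤ (≤-<-trans t≤r r<p) p∣t
      ...   | inj₂ p∣row = >⇒∤ ⦃ >-nonZero 0<row-b₀ ⦄ (≤-<-trans row-b₀≤2 (2<odd-prime p-prime p≢2)) p∣row

    σ∈ : Prime p → ¬ p ≡ 2 → r < p → p ∣ card H → σ ∈S H
    σ∈ p-prime p≢2 r<p p∣card with σ∈⊎σ-exponents-trivial p-prime
    ... | inj₁ σ∈H    = σ∈H
    ... | inj₂ trivial = contradiction p∣card (Counting.p∤card trivial p-prime p≢2 r<p)

  module τ-Exponents (H : Subgroup) (σ∈H : σ ∈S H) (j∉H : ¬ j ∈S H) where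
    open Membership H
    open Containingσ σ∈H
    open Avoidingj j∉H

    τ-exponent : ℕ → Set
    τ-exponent x = ∃ λ (c : Fin 2) → σ^ 0 τ^ x j^ toℕ c ∈S H

    τ-exponent? : Decidable τ-exponent
    τ-exponent? x = any? λ c → mem H (σ^ 0 τ^ x j^ toℕ c) Bool.≟ true

    τ-exponent-of : ∀ {a b c} → σ^ a τ^ b j^ c ∈S H → τ-exponent b
    τ-exponent-of {c = c} x∈H = c mod 2 , σ-shift 0 (∈-resp-≡ (σ^τ^j^-cong refl refl (sym (toℕ-mod-% c 2))) x∈H)

    τ-exponent-+ : ∀ {x y} → τ-exponent x → τ-exponent y → τ-exponent (x + y)
    τ-exponent-+ {x} {y} (c , x∈H) (c' , y∈H) =
      τ-exponent-of (∈-resp-≡ (σ^τ^j^-· 0 x (toℕ c) 0 y (toℕ c')) (·∈ H _ _ x∈H y∈H))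

    τ-exponent-∸ : ∀ {x y} → τ-exponent (x + y) → τ-exponent y → τ-exponent x
    τ-exponent-∸ {x} {y} (c , x+y∈H) (c' , y∈H) =
      τ-exponent-of (∈-resp-≡ (trans (·-inv 0 (x + y) (toℕ c) 0 y (toℕ c')) (σ^τ^j^-cong {c' = toℕ c + toℕ c'} refl exponent refl))
                              (·-inv∈ x+y∈H y∈H))
      where
      exponent : (x + y + (r ∸ y % r)) % r ≡ x % r
      exponent = trans (cong (_% r) (+-comm-right x y (r ∸ y % r))) (+-neg-cancelʳ r x y)
        where
        +-comm-right : ∀ a b c → a + b + c ≡ a + c + b
        +-comm-right = solve-∀

    τ-exponent-r : τ-exponent r
    τ-exponent-r = zero , ∈-resp-≡ (trans ε≡ (σ^τ^j^-cong refl (trans (0%n≡0 r) (sym (n%n≡0 r))) refl)) (ε∈ H)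

    least-τ-exponent : ∃ λ m → m ∣ r × τ-exponent m × (∀ {x} → τ-exponent x → m ∣ x)
    least-τ-exponent with multiples-of-least τ-exponent? r τ-exponent-r τ-exponent-+ τ-exponent-∸
    ... | m , m∣r , divides-all , multiple-in = m , m∣r , multiple-in ∣-refl , divides-all

    -- Every x ∈ H is σ^a g^n: the τ-exponent of x is a multiple n·m, and then
    -- the j-exponents of x and g^n agree since j ∉ H.
    generated-by : ∀ {m c} → σ^ 0 τ^ m j^ c ∈S H → (∀ {x} → τ-exponent x → m ∣ x) →
                   IsGeneratedBy H (σ ∷ σ^ 0 τ^ m j^ c ∷ [])
    generated-by {m} {c} g∈H m∣τ-exponents x = to x , generated⊆ gens⊆H
      where
      g = σ^ 0 τ^ m j^ c

      gens⊆H : ∀ {y} → y ∈ σ ∷ g ∷ [] → y ∈S H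
      gens⊆H (here refl)         = σ∈H
      gens⊆H (there (here refl)) = g∈H

      to : ∀ x → x ∈S H → ⟨ σ ∷ g ∷ [] ⟩∋ x
      to ⟨ a , b , c' ⟩ x∈H with m∣τ-exponents (τ-exponent-of (∈-resp-≡ (σ^τ^j^-η a b c') x∈H))
      ... | divides n b≡n*m = subst (⟨ σ ∷ g ∷ [] ⟩∋_) σ^a·gⁿ≡x
              (mul (pow-generated (toℕ a) (gen (here refl))) (pow-generated n (gen (there (here refl)))))
        where
        x∈H′ : σ^ toℕ a τ^ toℕ b j^ toℕ c' ∈S H
        x∈H′ = ∈-resp-≡ (σ^τ^j^-η a b c') x∈H
        j-exponents : toℕ c' % 2 ≡ (n * c) % 2
        j-exponents = j-exponent-unique x∈H′ (∈-resp-≡ (τ^j^-pow m c n) (pow∈ n g∈H)) (cong (_% r) b≡n*m)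
        σ^a·gⁿ≡x : pow σ (toℕ a) · pow g n ≡ ⟨ a , b , c' ⟩
        σ^a·gⁿ≡x = begin
          pow σ (toℕ a) · pow g n                             ≡⟨ cong₂ _·_ (σ-pow (toℕ a)) (τ^j^-pow m c n) ⟩
          σ^ toℕ a τ^ 0 j^ 0 · σ^ 0 τ^ (n * m) j^ (n * c)      ≡⟨ σ^-· (toℕ a) 0 (n * m) (n * c) ⟩
          σ^ (toℕ a + 0) τ^ (n * m) j^ (n * c)                ≡⟨ σ^τ^j^-cong (cong (_% p) (+-identityʳ (toℕ a)))
                                                                             (cong (_% r) (sym b≡n*m)) (sym j-exponents) ⟩
          σ^ toℕ a τ^ toℕ b j^ toℕ c'                          ≡⟨ σ^τ^j^-η a b c' ⟨
          ⟨ a , b , c' ⟩                                       ∎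
          where open ≡-Reasoning

  record NestedGenerators (I D : Subgroup) : Set where
    field
      m k         : ℕ
      c           : Fin 2
      km∣r        : k * m ∣ r
      D-generated : IsGeneratedBy D (σ ∷ σ^ 0 τ^ m j^ toℕ c ∷ [])
      I-generated : IsGeneratedBy I (σ ∷ pow (σ^ 0 τ^ m j^ toℕ c) k ∷ [])

  module Nested (I D : Subgroup) (I⊆D : I ⊆S D) (σ∈I : σ ∈S I) (j∉D : ¬ j ∈S D) where
    private
      module ID = Membership I
      module DD = Membership D
      module Iτ = τ-Exponents I σ∈I (j∉D ∘ I⊆D j)
      module Dτ = τ-Exponents D (I⊆D σ σ∈I) j∉D
      open DD.Containingσ.Avoidingj (I⊆D σ σ∈I) j∉D using (j-exponent-unique)

    -- The generator of I is a power of that of D: both lie in D and have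
    -- τ-exponent k·m, so their j-exponents agree.
    nested-generators : NestedGenerators I D
    nested-generators with Dτ.least-τ-exponent | Iτ.least-τ-exponent
    ... | m , _ , (c , g∈D) , m∣Dτ | mI , mI∣r , (cI , gI∈I) , mI∣Iτ with m∣Dτ (cI , I⊆D _ gI∈I)
    ... | divides k mI≡k*m = record
      { m = m ; k = k ; c = c
      ; km∣r = subst (_∣ r) mI≡k*m mI∣r
      ; D-generated = Dτ.generated-by g∈D m∣Dτ
      ; I-generated = subst (λ g → IsGeneratedBy I (σ ∷ g ∷ [])) (sym (τ^j^-pow m (toℕ c) k))
                            (Iτ.generated-by gᵏ∈I (subst (λ n → ∀ {x} → Iτ.τ-exponent x → n ∣ x) mI≡k*m mI∣Iτ))
      }
      where
      j-exponents : toℕ cI % 2 ≡ k * toℕ c % 2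
      j-exponents = j-exponent-unique (I⊆D _ gI∈I) (DD.∈-resp-≡ (τ^j^-pow m (toℕ c) k) (DD.pow∈ k g∈D))
                                      (cong (_% r) mI≡k*m)
      gᵏ∈I : σ^ 0 τ^ (k * m) j^ (k * toℕ c) ∈S I
      gᵏ∈I = ID.∈-resp-≡ (σ^τ^j^-cong refl (cong (_% r) mI≡k*m) j-exponents) gI∈I

  -- r/e, r/d and e/d are the quotients of e ∣ r, d ∣ r and d ∣ e.
  IsCaseIorII : (I D : Subgroup) {d e : ℕ} → d ∣ e → e ∣ r → Set
  IsCaseIorII I D {e = e} d∣e e∣r =
    (IsGeneratedBy D (σ ∷ pow τ (_∣_.quotient e∣r) ∷ []) ×
     IsGeneratedBy I (σ ∷ pow τ (_∣_.quotient (∣-trans d∣e e∣r)) ∷ []))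
    ⊎
    (2 ∣ e ×
     IsGeneratedBy D (σ ∷ (pow τ (_∣_.quotient e∣r) · j) ∷ []) ×
     IsGeneratedBy I (σ ∷ pow (pow τ (_∣_.quotient e∣r) · j) (_∣_.quotient d∣e) ∷ []))

  classification : (I D : Subgroup) → σ ∈S D → ¬ (j ∈S D) → NestedGenerators I D →
    Σ ℕ λ d → Σ ℕ λ e → Σ (d ∣ e) λ d∣e → Σ (e ∣ r) λ e∣r → 0 < d × 0 < e × IsCaseIorII I D d∣e e∣r
  classification I D σ∈D j∉D N =
    d , k * d , d∣e , e∣r , 0<d , 0<e , generators c D-generated I-generated
    where
    open NestedGenerators N
    d : ℕ
    d = _∣_.quotient km∣r
    r≡d*km : r ≡ d * (k * m)
    r≡d*km = _∣_.equality km∣r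
    d∣e : d ∣ k * d
    d∣e = divides k refl
    e∣r : k * d ∣ r
    e∣r = divides m (trans r≡d*km (reassociate d k m))
      where
      reassociate : ∀ x y z → x * (y * z) ≡ z * (y * x)
      reassociate = solve-∀
    0<d : 0 < d
    0<d = quotient-positive km∣r
    0<e : 0 < k * d
    0<e = quotient-positive (divides (k * d) (trans (_∣_.equality e∣r) (*-comm m (k * d))))
    instance
      d≢0 : NonZero d
      d≢0 = >-nonZero 0<d
    quotient-d∣r : _∣_.quotient (∣-trans d∣e e∣r) ≡ k * m
    quotient-d∣r = quotient-unique (∣-trans d∣e e∣r) (divides (k * m) (trans r≡d*km (*-comm d (k * m))))

    generators : ∀ c → IsGeneratedBy D (σ ∷ σ^ 0 τ^ m j^ toℕ c ∷ []) →
                 IsGeneratedBy I (σ ∷ pow (σ^ 0 τ^ m j^ toℕ c) k ∷ []) → IsCaseIorII I D d∣e e∣r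
    generators zero D-gens I-gens = inj₁ (subst (λ g → IsGeneratedBy D (σ ∷ g ∷ [])) (sym (τ-pow m)) D-gens ,
                                          subst (λ g → IsGeneratedBy I (σ ∷ g ∷ [])) gᵏ≡ I-gens)
      where
      open ≡-Reasoning
      gᵏ≡ : pow (σ^ 0 τ^ m j^ 0) k ≡ pow τ (_∣_.quotient (∣-trans d∣e e∣r))
      gᵏ≡ = begin
        pow (σ^ 0 τ^ m j^ 0) k                        ≡⟨ τ^j^-pow m 0 k ⟩
        σ^ 0 τ^ (k * m) j^ (k * 0)                    ≡⟨ σ^τ^j^-cong refl refl (cong (_% 2) (*-zeroʳ k)) ⟩
        σ^ 0 τ^ (k * m) j^ 0                          ≡⟨ τ-pow (k * m) ⟨
        pow τ (k * m)                                 ≡⟨ cong (pow τ) quotient-d∣r ⟨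
        pow τ (_∣_.quotient (∣-trans d∣e e∣r))        ∎
    generators (suc zero) D-gens I-gens =
      inj₂ (Containingσ.Avoidingj.τ^j-period-even σ∈D j∉D g∈D (_∣_.equality e∣r) ,
            subst (λ g → IsGeneratedBy D (σ ∷ g ∷ [])) (sym (τ^·j m)) D-gens ,
            subst (λ g → IsGeneratedBy I (σ ∷ pow g k ∷ [])) (sym (τ^·j m)) I-gens)
      where
      open Membership D
      g∈D : σ^ 0 τ^ m j^ 1 ∈S D
      g∈D = proj₂ (D-gens _) (gen (there (here refl)))

lemma4p3 : (p r s : ℕ) → {{_ : NonZero p}} → {{_ : NonZero r}} →
    Prime p → ¬ (p ≡ 2) →
    s ^ r % p ≡ 1 → (∀ k → 0 < k → k < r → ¬ (s ^ k % p ≡ 1)) →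
    let open G p r s in
    (I D : Subgroup) → I ⊆S D → NormalIn I D → CyclicQuotient D I →
    p ∣ card I → ¬ (j ∈S D) →
    Σ ℕ λ d → Σ ℕ λ e → Σ (d ∣ e) λ d∣e → Σ (e ∣ r) λ e∣r →
      0 < d × 0 < e ×
      ((IsGeneratedBy D (σ ∷ pow τ (_∣_.quotient e∣r) ∷ []) ×
        IsGeneratedBy I (σ ∷ pow τ (_∣_.quotient (∣-trans d∣e e∣r)) ∷ []))
      ⊎
       (2 ∣ e ×
        IsGeneratedBy D (σ ∷ (pow τ (_∣_.quotient e∣r) · j) ∷ []) ×
        IsGeneratedBy I (σ ∷ pow (pow τ (_∣_.quotient e∣r) · j) (_∣_.quotient d∣e) ∷ [])))
lemma4p3 p r s p-prime p≢2 sʳ≡1 minimal I D I⊆D _ _ p∣#I j∉D =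
  classification I D (I⊆D σ σ∈I) j∉D (Nested.nested-generators I D I⊆D σ∈I j∉D)
  where
  open Coordinates p r s sʳ≡1
  σ∈I : σ ∈S I
  σ∈I = σ-Exponents.σ∈ I p-prime p≢2 (order<modulus minimal) p∣#I
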